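{- Let $\mathcal{G}$ be an Abelian group whose set of involutions is $I^\star=\{i_1,\dots,i_{2^k-1}\}$ for some integer $k\geq 2$, and let $I=I^\star\cup\{0\}$. Then for any integer $r$ with $0\leq r\leq 2^k$, there exists a set $R\subseteq I$ with $|R|=r$ and $\sum_{i\in R} i=0$ if and only if $r\notin\{2,\,2^k-2\}$.
   Context: Groups are written additively with neutral element $0$. An involution is an element of order exactly $2$. For a finite set $R$ of group elements, $\sum_{i\in R} i$ denotes the sum of all elements of $R$ (the empty sum being $0$). -}

module Defs where

open import Level using (Level)
open import Data.Nat using (ℕ; zero; suc)
open import Data.Bool using (true; false)
open import Data.Fin using (Fin)
import Data.Fin as F
open import Data.Vec using (_∷_; [])
open import Data.Fin.Subset using (Subset)
open import Data.Product using (Σ; _×_)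
open import Relation.Nullary using (¬_)
import Relation.Binary.PropositionalEquality
open import Algebra.Bundles using (AbelianGroup)

module _ {c ℓ : Level} (G : AbelianGroup c ℓ) where
  open AbelianGroup G

  IsInvolution : Carrier → Set ℓ
  IsInvolution x = ¬ (x ≈ 0#) × (x + x ≈ 0#)
    where 0# = ε ; _+_ = _∙_

  subsetSum : {n : ℕ} → (Fin n → Carrier) → Subset n → Carrier
  subsetSum {zero} f [] = ε
  subsetSum {suc n} f (true ∷ S) = f F.zero ∙ subsetSum (λ j → f (F.suc j)) S
  subsetSum {suc n} f (false ∷ S) = subsetSum (λ j → f (F.suc j)) S

  EnumeratesInvolutions : {m : ℕ} → (Fin m → Carrier) → Set (c Level.⊔ ℓ)
  EnumeratesInvolutions {m} inv =
    ((j : Fin m) → IsInvolution (inv j))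
    × ((j j′ : Fin m) → inv j ≈ inv j′ → j Relation.Binary.PropositionalEquality.≡ j′)
    × ((x : Carrier) → IsInvolution x → Σ (Fin m) λ j → x ≈ inv j)

  withZero : {m : ℕ} → (Fin m → Carrier) → Fin (suc m) → Carrier
  withZero inv F.zero = ε
  withZero inv (F.suc j) = inv j

-- Adding 0 to I* gives a subgroup I of exponent 2 and order 2^k.  Fix a subgroup
-- H = {0, a, b, a + b} of order 4: each of its cosets sums to 0 and I is a disjoint
-- union of them, so zero-sum sets of every size 4m + s are obtained by adding
-- whole cosets to a small zero-sum "seed" of size s: {} for s = 0, {0} for s = 1,
-- H \ {0} for s = 3, and for s = 2 (with m ≥ 1) the six elements
-- a, b, x, x + a, y, y + b taken from three distinct cosets.  Conversely two
-- distinct involutions never sum to 0, and as I itself sums to 0, neither do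
-- the complements of pairs.
module Submission where

open import Defs
open import Level using (Level)
open import Data.Nat using (ℕ; zero; suc; _+_; _*_; _∸_; _^_; _≤_; _<_; s≤s)
open import Data.Nat.Properties
  using (≤-trans; ≤∧≢⇒<; n≤1+n; m≤m+n; m≤n+m; +-monoʳ-≤; +-monoʳ-<; *-monoˡ-≤; *-cancelʳ-<; *-assoc; +-suc;
         m∸[m∸n]≡n; ≤-reflexive; suc-pred; m^n≢0; suc-injective; ∸-monoˡ-≤; ^-monoʳ-≤)
open import Data.Nat.Divisibility using (_∣_; divides; m∣m*n)
open import Data.Fin using (Fin)
import Data.Fin as Fin
import Data.Fin.Properties as Fin
open import Data.Fin.Subset using (Subset; ∣_∣; _∈_; _∉_; _⊆_; _∪_; ⁅_⁆; ∁)
  renaming (⊥ to ∅; ⊤ to full)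
open import Data.Fin.Subset.Properties
  using (x∈⁅x⁆; x∈⁅y⁆⇒x≡y; x∈p∪q⁺; x∈p∪q⁻; p⊆p∪q; q⊆p∪q; ∣⁅x⁆∣≡1; ∣⊥∣≡0; ∉⊥; ∣p∣≤n;
         ∣p∣≡n⇒p≡⊤; drop-there; x∈∁p⇒x∉p; p∪∁p≡⊤; ∣∁p∣≡n∸∣p∣)
open import Data.Vec using ([]; _∷_; here; there)
open import Data.Bool using (true; false)
open import Data.Product using (Σ; ∃; _×_; _,_; proj₁; proj₂)
open import Data.Sum using (_⊎_; inj₁; inj₂; [_,_]′)
open import Data.Empty using (⊥-elim)
open import Function using (id; _∘_)
open import Relation.Nullary using (¬_; yes; no)
open import Relation.Binary.PropositionalEquality as ≡ using (_≡_; _≢_; refl; cong; cong₂; subst)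
open import Function.Bundles using (_⇔_; mk⇔)
open import Algebra.Bundles using (AbelianGroup)

private
  variable
    n : ℕ
    p q r p′ q′ : Subset n
    i j : Fin n

Disjoint : Subset n → Subset n → Set
Disjoint p q = ∀ {x} → x ∈ p → x ∉ q

disjoint-sym : Disjoint p q → Disjoint q p
disjoint-sym d x∈q x∈p = d x∈p x∈q

disjoint-⊆ : p′ ⊆ p → q′ ⊆ q → Disjoint p q → Disjoint p′ q′
disjoint-⊆ p′⊆p q′⊆q d x∈p′ x∈q′ = d (p′⊆p x∈p′) (q′⊆q x∈q′)

disjoint-∪ˡ : Disjoint p r → Disjoint q r → Disjoint (p ∪ q) r
disjoint-∪ˡ {p = p} {q = q} dp dq x∈p∪q with x∈p∪q⁻ p q x∈p∪q
... | inj₁ x∈p = dp x∈p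
... | inj₂ x∈q = dq x∈q

⁅⁆-disjoint : i ≢ j → Disjoint ⁅ i ⁆ ⁅ j ⁆
⁅⁆-disjoint i≢j x∈⁅i⁆ x∈⁅j⁆ = i≢j (≡.trans (≡.sym (x∈⁅y⁆⇒x≡y _ x∈⁅i⁆)) (x∈⁅y⁆⇒x≡y _ x∈⁅j⁆))

disjoint-tail : ∀ {s t} → Disjoint (s ∷ p) (t ∷ q) → Disjoint p q
disjoint-tail d x∈p x∈q = d (there x∈p) (there x∈q)

⁅⁆⊆ : i ∈ p → ⁅ i ⁆ ⊆ p
⁅⁆⊆ {p = p} i∈p x∈⁅i⁆ = subst (_∈ p) (≡.sym (x∈⁅y⁆⇒x≡y _ x∈⁅i⁆)) i∈p

∪-⊆ : p ⊆ r → q ⊆ r → p ∪ q ⊆ r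
∪-⊆ {p = p} {q = q} p⊆r q⊆r x∈p∪q with x∈p∪q⁻ p q x∈p∪q
... | inj₁ x∈p = p⊆r x∈p
... | inj₂ x∈q = q⊆r x∈q

∪-mono : p′ ⊆ p → q′ ⊆ q → p′ ∪ q′ ⊆ p ∪ q
∪-mono {p = p} {q = q} p′⊆p q′⊆q =
  ∪-⊆ (p⊆p∪q q ∘ p′⊆p) (q⊆p∪q p q ∘ q′⊆q)

∣p∪q∣≡∣p∣+∣q∣ : Disjoint p q → ∣ p ∪ q ∣ ≡ ∣ p ∣ + ∣ q ∣
∣p∪q∣≡∣p∣+∣q∣ {p = []}        {q = []}        d = refl
∣p∪q∣≡∣p∣+∣q∣ {p = true ∷ p}  {q = true ∷ q}  d = ⊥-elim (d here here)
∣p∪q∣≡∣p∣+∣q∣ {p = true ∷ p}  {q = false ∷ q} d =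
  cong suc (∣p∪q∣≡∣p∣+∣q∣ (disjoint-tail d))
∣p∪q∣≡∣p∣+∣q∣ {p = false ∷ p} {q = true ∷ q}  d =
  ≡.trans (cong suc (∣p∪q∣≡∣p∣+∣q∣ (disjoint-tail d)))
          (≡.sym (+-suc ∣ p ∣ ∣ q ∣))
∣p∪q∣≡∣p∣+∣q∣ {p = false ∷ p} {q = false ∷ q} d =
  ∣p∪q∣≡∣p∣+∣q∣ (disjoint-tail d)

∣p∣<n⇒∃∉ : ∀ {n} {p : Subset n} → ∣ p ∣ < n → ∃ λ x → x ∉ p
∣p∣<n⇒∃∉ {p = []} ()
∣p∣<n⇒∃∉ {p = false ∷ p} _ = Fin.zero , λ ()
∣p∣<n⇒∃∉ {p = true ∷ p} (s≤s ∣p∣<n) with ∣p∣<n⇒∃∉ ∣p∣<n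
... | x , x∉p = Fin.suc x , x∉p ∘ drop-there

data Mod4 : ℕ → Set where
  rem0 : ∀ m → Mod4 (m * 4)
  rem1 : ∀ m → Mod4 (1 + m * 4)
  rem2 : ∀ m → Mod4 (2 + m * 4)
  rem3 : ∀ m → Mod4 (3 + m * 4)

mod4 : ∀ r → Mod4 r
mod4 zero = rem0 0
mod4 (suc r) with mod4 r
... | rem0 m = rem1 m
... | rem1 m = rem2 m
... | rem2 m = rem3 m
... | rem3 m = rem0 (suc m)

m*4<n⇒[1+m]*4≤n : ∀ {m} → 4 ∣ n → m * 4 < n → suc m * 4 ≤ n
m*4<n⇒[1+m]*4≤n {m = m} (divides t refl) m*4<t*4 = *-monoˡ-≤ 4 (*-cancelʳ-< 4 m t m*4<t*4)

[1+m]*4+2≤n⇒[3+m]*4≤n : ∀ {m} → 4 ∣ n → 6 + m * 4 ≤ n → 6 + m * 4 ≢ n ∸ 2 → 12 + m * 4 ≤ n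
[1+m]*4+2≤n⇒[3+m]*4≤n {m = m} (divides (suc t) refl) (s≤s (s≤s (s≤s (s≤s le)))) ≢n∸2 =
  s≤s (s≤s (s≤s (s≤s (*-monoˡ-≤ 4 (≤∧≢⇒< 1+m≤t λ { refl → ≢n∸2 refl })))))
  where
  1+m≤t : suc m ≤ t
  1+m≤t = *-cancelʳ-< 4 m t (≤-trans (n≤1+n _) le)

module _ {α ℓ : Level} (G : AbelianGroup α ℓ) where
  open AbelianGroup G renaming (refl to ≈-refl)
  open import Algebra.Properties.AbelianGroup G using (∙-cancelˡ; inverseˡ-unique; inverseʳ-unique)
  open import Algebra.Properties.CommutativeSemigroup commutativeSemigroup using (interchange)
  open import Relation.Binary.Reasoning.Setoid setoid

  subsetSum-∅ : (f : Fin n → Carrier) → subsetSum G f ∅ ≈ ε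
  subsetSum-∅ {zero} f = ≈-refl
  subsetSum-∅ {suc n} f = subsetSum-∅ (f ∘ Fin.suc)

  subsetSum-⁅⁆ : (f : Fin n → Carrier) (i : Fin n) → subsetSum G f ⁅ i ⁆ ≈ f i
  subsetSum-⁅⁆ f Fin.zero = trans (∙-congˡ (subsetSum-∅ (f ∘ Fin.suc))) (identityʳ _)
  subsetSum-⁅⁆ f (Fin.suc i) = subsetSum-⁅⁆ (f ∘ Fin.suc) i

  subsetSum-∪ : (f : Fin n → Carrier) → Disjoint p q →
                subsetSum G f (p ∪ q) ≈ subsetSum G f p ∙ subsetSum G f q
  subsetSum-∪ {p = []} {q = []} f d = sym (identityˡ ε)
  subsetSum-∪ {p = true ∷ p} {q = true ∷ q} f d = ⊥-elim (d here here)
  subsetSum-∪ {p = true ∷ p} {q = false ∷ q} f d = begin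
    f Fin.zero ∙ subsetSum G _ (p ∪ q)                  ≈⟨ ∙-congˡ (subsetSum-∪ _ (disjoint-tail d)) ⟩
    f Fin.zero ∙ (subsetSum G _ p ∙ subsetSum G _ q)    ≈⟨ assoc _ _ _ ⟨
    (f Fin.zero ∙ subsetSum G _ p) ∙ subsetSum G _ q    ∎
  subsetSum-∪ {p = false ∷ p} {q = true ∷ q} f d = begin
    f Fin.zero ∙ subsetSum G _ (p ∪ q)                  ≈⟨ ∙-congˡ (subsetSum-∪ _ (disjoint-tail d)) ⟩
    f Fin.zero ∙ (subsetSum G _ p ∙ subsetSum G _ q)    ≈⟨ assoc _ _ _ ⟨
    (f Fin.zero ∙ subsetSum G _ p) ∙ subsetSum G _ q    ≈⟨ ∙-congʳ (comm _ _) ⟩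
    (subsetSum G _ p ∙ f Fin.zero) ∙ subsetSum G _ q    ≈⟨ assoc _ _ _ ⟩
    subsetSum G _ p ∙ (f Fin.zero ∙ subsetSum G _ q)    ∎
  subsetSum-∪ {p = false ∷ p} {q = false ∷ q} f d =
    subsetSum-∪ _ (disjoint-tail d)

  subsetSum-∣p∣≡0 : (f : Fin n → Carrier) → ∣ p ∣ ≡ 0 → subsetSum G f p ≈ ε
  subsetSum-∣p∣≡0 {p = []} f _ = ≈-refl
  subsetSum-∣p∣≡0 {p = false ∷ p} f ∣p∣≡0 = subsetSum-∣p∣≡0 (f ∘ Fin.suc) ∣p∣≡0

  subsetSum-∣p∣≡1 : (f : Fin n → Carrier) → ∣ p ∣ ≡ 1 → ∃ λ i → subsetSum G f p ≈ f i
  subsetSum-∣p∣≡1 {p = true ∷ p} f ∣p∣≡1 =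
    Fin.zero , trans (∙-congˡ (subsetSum-∣p∣≡0 (f ∘ Fin.suc) (suc-injective ∣p∣≡1))) (identityʳ _)
  subsetSum-∣p∣≡1 {p = false ∷ p} f ∣p∣≡1 with subsetSum-∣p∣≡1 (f ∘ Fin.suc) ∣p∣≡1
  ... | i , sum≈fi = Fin.suc i , sum≈fi

  subsetSum-∣p∣≡2 : (f : Fin n → Carrier) → ∣ p ∣ ≡ 2 →
                    ∃ λ i → ∃ λ j → i ≢ j × subsetSum G f p ≈ f i ∙ f j
  subsetSum-∣p∣≡2 {p = true ∷ p} f ∣p∣≡2 with subsetSum-∣p∣≡1 (f ∘ Fin.suc) (suc-injective ∣p∣≡2)
  ... | j , sum≈fj = Fin.zero , Fin.suc j , (λ ()) , ∙-congˡ sum≈fj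
  subsetSum-∣p∣≡2 {p = false ∷ p} f ∣p∣≡2 with subsetSum-∣p∣≡2 (f ∘ Fin.suc) ∣p∣≡2
  ... | i , j , i≢j , sum≈fifj = Fin.suc i , Fin.suc j , i≢j ∘ Fin.suc-injective , sum≈fifj

  x∙y≈ε⇒x≈y : ∀ {x y} → y ∙ y ≈ ε → x ∙ y ≈ ε → x ≈ y
  x∙y≈ε⇒x≈y {x} {y} yy≈ε xy≈ε = trans (inverseˡ-unique x y xy≈ε) (sym (inverseʳ-unique y y yy≈ε))

  ∙-square-cancel : ∀ {x} → x ∙ x ≈ ε → ∀ u v → (x ∙ u) ∙ (x ∙ v) ≈ u ∙ v
  ∙-square-cancel {x} xx≈ε u v = begin
    (x ∙ u) ∙ (x ∙ v)  ≈⟨ interchange x u x v ⟩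
    (x ∙ x) ∙ (u ∙ v)  ≈⟨ ∙-congʳ xx≈ε ⟩
    ε ∙ (u ∙ v)        ≈⟨ identityˡ _ ⟩
    u ∙ v              ∎

  -- e lists a subgroup of exponent 2 of G without repetition; sets of its elements
  -- are subsets of indices, on which _⊕_ mirrors the group law.
  module ElementaryTwoGroup {n : ℕ} (e : Fin n → Carrier)
    (e-injective : ∀ {i j} → e i ≈ e j → i ≡ j)
    (e-square : ∀ i → e i ∙ e i ≈ ε)
    (e-closed : ∀ i j → ∃ λ l → e l ≈ e i ∙ e j)
    (o a b : Fin n) (e-o : e o ≈ ε) (a≢o : a ≢ o) (b≢o : b ≢ o) (a≢b : a ≢ b)
    where

    ∑ : Subset n → Carrier
    ∑ = subsetSum G e

    ZeroSumOfSize : ℕ → Set ℓ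
    ZeroSumOfSize r = Σ (Subset n) λ R → (∣ R ∣ ≡ r) × ∑ R ≈ ε

    infixl 6 _⊕_
    _⊕_ : Fin n → Fin n → Fin n
    i ⊕ j = proj₁ (e-closed i j)

    e-⊕ : ∀ i j → e (i ⊕ j) ≈ e i ∙ e j
    e-⊕ i j = proj₂ (e-closed i j)

    ⊕-comm : ∀ i j → i ⊕ j ≡ j ⊕ i
    ⊕-comm i j = e-injective (begin
      e (i ⊕ j)  ≈⟨ e-⊕ i j ⟩
      e i ∙ e j  ≈⟨ comm _ _ ⟩
      e j ∙ e i  ≈⟨ e-⊕ j i ⟨
      e (j ⊕ i)  ∎)

    ⊕-assoc : ∀ i j l → (i ⊕ j) ⊕ l ≡ i ⊕ (j ⊕ l)
    ⊕-assoc i j l = e-injective (begin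
      e ((i ⊕ j) ⊕ l)    ≈⟨ trans (e-⊕ _ l) (∙-congʳ (e-⊕ i j)) ⟩
      (e i ∙ e j) ∙ e l  ≈⟨ assoc _ _ _ ⟩
      e i ∙ (e j ∙ e l)  ≈⟨ trans (e-⊕ i _) (∙-congˡ (e-⊕ j l)) ⟨
      e (i ⊕ (j ⊕ l))    ∎)

    ⊕-identityʳ : ∀ i → i ⊕ o ≡ i
    ⊕-identityʳ i = e-injective (trans (e-⊕ i o) (trans (∙-congˡ e-o) (identityʳ _)))

    ⊕-identityˡ : ∀ i → o ⊕ i ≡ i
    ⊕-identityˡ i = ≡.trans (⊕-comm o i) (⊕-identityʳ i)

    ⊕-self : ∀ i → i ⊕ i ≡ o
    ⊕-self i = e-injective (trans (e-⊕ i i) (trans (e-square i) (sym e-o)))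

    ⊕-involutive : ∀ i j → (i ⊕ j) ⊕ j ≡ i
    ⊕-involutive i j = ≡.trans (⊕-assoc i j j) (≡.trans (cong (i ⊕_) (⊕-self j)) (⊕-identityʳ i))

    ⊕-cancelˡ : ∀ i {j l} → i ⊕ j ≡ i ⊕ l → j ≡ l
    ⊕-cancelˡ i {j} {l} eq = e-injective (∙-cancelˡ (e i) (e j) (e l)
      (trans (sym (e-⊕ i j)) (trans (reflexive (cong e eq)) (e-⊕ i l))))

    c : Fin n
    c = a ⊕ b

    c≢o : c ≢ o
    c≢o c≡o = a≢b (≡.sym (⊕-cancelˡ a (≡.trans c≡o (≡.sym (⊕-self a)))))

    c≢a : c ≢ a
    c≢a c≡a = b≢o (⊕-cancelˡ a (≡.trans c≡a (≡.sym (⊕-identityʳ a))))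

    c≢b : c ≢ b
    c≢b c≡b = a≢o (⊕-cancelˡ b (≡.trans (⊕-comm b a) (≡.trans c≡b (≡.sym (⊕-identityʳ b)))))

    data InH : Fin n → Set where
      o∈H : InH o
      a∈H : InH a
      b∈H : InH b
      c∈H : InH c

    InH-⊕a : ∀ {w} → InH w → InH (w ⊕ a)
    InH-⊕a o∈H = subst InH (≡.sym (⊕-identityˡ a)) a∈H
    InH-⊕a a∈H = subst InH (≡.sym (⊕-self a)) o∈H
    InH-⊕a b∈H = subst InH (⊕-comm a b) c∈H
    InH-⊕a c∈H = subst InH (≡.sym (≡.trans (cong (_⊕ a) (⊕-comm a b)) (⊕-involutive b a))) b∈H

    InH-⊕b : ∀ {w} → InH w → InH (w ⊕ b)
    InH-⊕b o∈H = subst InH (≡.sym (⊕-identityˡ b)) b∈H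
    InH-⊕b a∈H = c∈H
    InH-⊕b b∈H = subst InH (≡.sym (⊕-self b)) o∈H
    InH-⊕b c∈H = subst InH (≡.sym (⊕-involutive a b)) a∈H

    InH-⊕ : ∀ {u v} → InH u → InH v → InH (u ⊕ v)
    InH-⊕ u∈H o∈H = subst InH (≡.sym (⊕-identityʳ _)) u∈H
    InH-⊕ u∈H a∈H = InH-⊕a u∈H
    InH-⊕ u∈H b∈H = InH-⊕b u∈H
    InH-⊕ {u} u∈H c∈H = subst InH (⊕-assoc u a b) (InH-⊕b (InH-⊕a u∈H))

    Closed : Subset n → Set
    Closed S = ∀ {x w} → x ∈ S → InH w → x ⊕ w ∈ S

    closed-∅ : Closed ∅
    closed-∅ x∈∅ _ = ⊥-elim (∉⊥ x∈∅)

    closed-∪ : Closed p → Closed q → Closed (p ∪ q)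
    closed-∪ {p = p} {q = q} p-closed q-closed x∈p∪q w∈H with x∈p∪q⁻ p q x∈p∪q
    ... | inj₁ x∈p = x∈p∪q⁺ (inj₁ (p-closed x∈p w∈H))
    ... | inj₂ x∈q = x∈p∪q⁺ (inj₂ (q-closed x∈q w∈H))

    pair : Fin n → Fin n → Fin n → Subset n
    pair l u v = ⁅ l ⊕ u ⁆ ∪ ⁅ l ⊕ v ⁆

    ∈pair⁻ : ∀ {x l u v} → x ∈ pair l u v → x ≡ l ⊕ u ⊎ x ≡ l ⊕ v
    ∈pair⁻ {l = l} {u} {v} x∈pair with x∈p∪q⁻ ⁅ l ⊕ u ⁆ ⁅ l ⊕ v ⁆ x∈pair
    ... | inj₁ x∈⁅lu⁆ = inj₁ (x∈⁅y⁆⇒x≡y _ x∈⁅lu⁆)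
    ... | inj₂ x∈⁅lv⁆ = inj₂ (x∈⁅y⁆⇒x≡y _ x∈⁅lv⁆)

    ⁅⊕⁆-disjoint : ∀ l {u v} → u ≢ v → Disjoint ⁅ l ⊕ u ⁆ ⁅ l ⊕ v ⁆
    ⁅⊕⁆-disjoint l u≢v = ⁅⁆-disjoint (u≢v ∘ ⊕-cancelˡ l)

    ∣pair∣≡2 : ∀ l {u v} → u ≢ v → ∣ pair l u v ∣ ≡ 2
    ∣pair∣≡2 l {u} {v} u≢v =
      ≡.trans (∣p∪q∣≡∣p∣+∣q∣ (⁅⊕⁆-disjoint l u≢v)) (cong₂ _+_ (∣⁅x⁆∣≡1 (l ⊕ u)) (∣⁅x⁆∣≡1 (l ⊕ v)))

    ∑-pair : ∀ l {u v} → u ≢ v → ∑ (pair l u v) ≈ e u ∙ e v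
    ∑-pair l {u} {v} u≢v = begin
      ∑ (pair l u v)             ≈⟨ subsetSum-∪ e (⁅⊕⁆-disjoint l u≢v) ⟩
      ∑ ⁅ l ⊕ u ⁆ ∙ ∑ ⁅ l ⊕ v ⁆  ≈⟨ ∙-cong (subsetSum-⁅⁆ e _) (subsetSum-⁅⁆ e _) ⟩
      e (l ⊕ u) ∙ e (l ⊕ v)      ≈⟨ ∙-cong (e-⊕ l u) (e-⊕ l v) ⟩
      (e l ∙ e u) ∙ (e l ∙ e v)  ≈⟨ ∙-square-cancel (e-square l) _ _ ⟩
      e u ∙ e v                  ∎

    pair-disjoint : ∀ l {u v u′ v′} → u ≢ u′ → u ≢ v′ → v ≢ u′ → v ≢ v′ →
                    Disjoint (pair l u v) (pair l u′ v′)
    pair-disjoint l u≢u′ u≢v′ v≢u′ v≢v′ x∈uv x∈u′v′ with ∈pair⁻ x∈uv | ∈pair⁻ x∈u′v′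
    ... | inj₁ refl | inj₁ eq = u≢u′ (⊕-cancelˡ l eq)
    ... | inj₁ refl | inj₂ eq = u≢v′ (⊕-cancelˡ l eq)
    ... | inj₂ refl | inj₁ eq = v≢u′ (⊕-cancelˡ l eq)
    ... | inj₂ refl | inj₂ eq = v≢v′ (⊕-cancelˡ l eq)

    -- Grouped so that each pair sums to e c.
    coset : Fin n → Subset n
    coset l = pair l o c ∪ pair l a b

    ∈coset⁺ : ∀ l {w} → InH w → l ⊕ w ∈ coset l
    ∈coset⁺ l o∈H = x∈p∪q⁺ (inj₁ (x∈p∪q⁺ (inj₁ (x∈⁅x⁆ _))))
    ∈coset⁺ l c∈H = x∈p∪q⁺ (inj₁ (x∈p∪q⁺ (inj₂ (x∈⁅x⁆ _))))
    ∈coset⁺ l a∈H = x∈p∪q⁺ (inj₂ (x∈p∪q⁺ (inj₁ (x∈⁅x⁆ _))))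
    ∈coset⁺ l b∈H = x∈p∪q⁺ (inj₂ (x∈p∪q⁺ (inj₂ (x∈⁅x⁆ _))))

    ∈coset⁻ : ∀ {x} l → x ∈ coset l → ∃ λ w → InH w × x ≡ l ⊕ w
    ∈coset⁻ l x∈coset with x∈p∪q⁻ (pair l o c) (pair l a b) x∈coset
    ... | inj₁ x∈oc = [ (λ x≡ → o , o∈H , x≡) , (λ x≡ → c , c∈H , x≡) ]′ (∈pair⁻ x∈oc)
    ... | inj₂ x∈ab = [ (λ x≡ → a , a∈H , x≡) , (λ x≡ → b , b∈H , x≡) ]′ (∈pair⁻ x∈ab)

    pair⊆coset : ∀ l {u v} → InH u → InH v → pair l u v ⊆ coset l
    pair⊆coset l u∈H v∈H x∈pair with ∈pair⁻ x∈pair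
    ... | inj₁ refl = ∈coset⁺ l u∈H
    ... | inj₂ refl = ∈coset⁺ l v∈H

    coset-closed : ∀ l → Closed (coset l)
    coset-closed l x∈coset w∈H with ∈coset⁻ l x∈coset
    ... | w′ , w′∈H , refl = subst (_∈ coset l) (≡.sym (⊕-assoc l w′ _)) (∈coset⁺ l (InH-⊕ w′∈H w∈H))

    oc#ab : ∀ l → Disjoint (pair l o c) (pair l a b)
    oc#ab l = pair-disjoint l (a≢o ∘ ≡.sym) (b≢o ∘ ≡.sym) c≢a c≢b

    ∣coset∣≡4 : ∀ l → ∣ coset l ∣ ≡ 4
    ∣coset∣≡4 l = ≡.trans (∣p∪q∣≡∣p∣+∣q∣ (oc#ab l))
                          (cong₂ _+_ (∣pair∣≡2 l (c≢o ∘ ≡.sym)) (∣pair∣≡2 l a≢b))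

    eo∙x≈x : ∀ x → e o ∙ x ≈ x
    eo∙x≈x x = trans (∙-congʳ e-o) (identityˡ x)

    ab≈c : e a ∙ e b ≈ e c
    ab≈c = sym (e-⊕ a b)

    ∑-coset≈ε : ∀ l → ∑ (coset l) ≈ ε
    ∑-coset≈ε l = begin
      ∑ (coset l)                         ≈⟨ subsetSum-∪ e (oc#ab l) ⟩
      ∑ (pair l o c) ∙ ∑ (pair l a b)     ≈⟨ ∙-cong (∑-pair l (c≢o ∘ ≡.sym)) (∑-pair l a≢b) ⟩
      (e o ∙ e c) ∙ (e a ∙ e b)           ≈⟨ ∙-cong (eo∙x≈x _) ab≈c ⟩
      e c ∙ e c                           ≈⟨ e-square c ⟩
      ε                                   ∎

    coset-disjoint : ∀ {S l} → Closed S → l ∉ S → Disjoint (coset l) S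
    coset-disjoint {l = l} S-closed l∉S x∈coset x∈S with ∈coset⁻ l x∈coset
    ... | w , w∈H , refl = l∉S (subst (_∈ _) (⊕-involutive l w) (S-closed x∈S w∈H))

    ∃-coset-disjoint : ∀ {S} → Closed S → ∣ S ∣ < n → ∃ λ l → Disjoint (coset l) S
    ∃-coset-disjoint S-closed ∣S∣<n with ∣p∣<n⇒∃∉ ∣S∣<n
    ... | l , l∉S = l , coset-disjoint S-closed l∉S

    record CosetUnion (E : Subset n) (m : ℕ) : Set ℓ where
      field
        set    : Subset n
        closed : Closed set
        avoids : Disjoint set E
        card   : ∣ set ∣ ≡ m * 4
        sum≈ε  : ∑ set ≈ ε

    cosetUnion : ∀ {E} → Closed E → ∀ m → ∣ E ∣ + m * 4 ≤ n → CosetUnion E m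
    cosetUnion E-closed zero _ = record
      { set = ∅ ; closed = closed-∅ ; avoids = λ x∈∅ _ → ∉⊥ x∈∅
      ; card = ∣⊥∣≡0 n ; sum≈ε = subsetSum-∅ e }
    cosetUnion {E} E-closed (suc m) room = record
      { set    = coset l ∪ set
      ; closed = closed-∪ (coset-closed l) closed
      ; avoids = disjoint-∪ˡ (disjoint-⊆ id (p⊆p∪q _) l-disjoint) avoids
      ; card   = ≡.trans (∣p∪q∣≡∣p∣+∣q∣ l-disjoint-set) (cong₂ _+_ (∣coset∣≡4 l) card)
      ; sum≈ε  = trans (subsetSum-∪ e l-disjoint-set)
                       (trans (∙-cong (∑-coset≈ε l) sum≈ε) (identityˡ ε))
      }
      where
      open CosetUnion (cosetUnion E-closed m (≤-trans (+-monoʳ-≤ ∣ E ∣ (m≤n+m (m * 4) 4)) room))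
      ∣E∪set∣<n : ∣ E ∪ set ∣ < n
      ∣E∪set∣<n =
        subst (_< n) (≡.sym (≡.trans (∣p∪q∣≡∣p∣+∣q∣ (disjoint-sym avoids)) (cong (∣ E ∣ +_) card)))
              (≤-trans (+-monoʳ-< ∣ E ∣ (s≤s (m≤n+m (m * 4) 3))) room)
      l : Fin n
      l = proj₁ (∃-coset-disjoint (closed-∪ E-closed closed) ∣E∪set∣<n)
      l-disjoint : Disjoint (coset l) (E ∪ set)
      l-disjoint = proj₂ (∃-coset-disjoint (closed-∪ E-closed closed) ∣E∪set∣<n)
      l-disjoint-set : Disjoint (coset l) set
      l-disjoint-set = disjoint-⊆ id (q⊆p∪q E set) l-disjoint

    -- A zero-sum core of size s inside a closed hull of size k: adjoining m cosets
    -- outside the hull yields zero-sum sets of size s + 4m.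
    record Seed (s k : ℕ) : Set ℓ where
      field
        core        : Subset n
        hull        : Subset n
        hull-closed : Closed hull
        ∣hull∣      : ∣ hull ∣ ≡ k
        core⊆hull   : core ⊆ hull
        ∣core∣      : ∣ core ∣ ≡ s
        ∑core≈ε     : ∑ core ≈ ε

    grow : ∀ {s k} → Seed s k → ∀ m → k + m * 4 ≤ n → ZeroSumOfSize (s + m * 4)
    grow seed m room =
      core ∪ set ,
      ≡.trans (∣p∪q∣≡∣p∣+∣q∣ core#set) (cong₂ _+_ ∣core∣ card) ,
      trans (subsetSum-∪ e core#set) (trans (∙-cong ∑core≈ε sum≈ε) (identityˡ ε))
      where
      open Seed seed
      open CosetUnion (cosetUnion hull-closed m (subst (λ k → k + m * 4 ≤ n) (≡.sym ∣hull∣) room))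
      core#set : Disjoint core set
      core#set = disjoint-⊆ core⊆hull id (disjoint-sym avoids)

    seed₀ : Seed 0 0
    seed₀ = record
      { core = ∅ ; hull = ∅ ; hull-closed = closed-∅ ; ∣hull∣ = ∣⊥∣≡0 n
      ; core⊆hull = id ; ∣core∣ = ∣⊥∣≡0 n ; ∑core≈ε = subsetSum-∅ e }

    seed₁ : Seed 1 4
    seed₁ = record
      { core = ⁅ o ⁆ ; hull = coset o ; hull-closed = coset-closed o ; ∣hull∣ = ∣coset∣≡4 o
      ; core⊆hull = ⁅⁆⊆ (subst (_∈ coset o) (⊕-identityʳ o) (∈coset⁺ o o∈H))
      ; ∣core∣ = ∣⁅x⁆∣≡1 o ; ∑core≈ε = trans (subsetSum-⁅⁆ e o) e-o }

    seed₃ : Seed 3 4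
    seed₃ = record
      { core = pair o a b ∪ ⁅ o ⊕ c ⁆ ; hull = coset o ; hull-closed = coset-closed o
      ; ∣hull∣ = ∣coset∣≡4 o
      ; core⊆hull = ∪-⊆ (pair⊆coset o a∈H b∈H) (⁅⁆⊆ (∈coset⁺ o c∈H))
      ; ∣core∣ = ≡.trans (∣p∪q∣≡∣p∣+∣q∣ ab#c) (cong₂ _+_ (∣pair∣≡2 o a≢b) (∣⁅x⁆∣≡1 (o ⊕ c)))
      ; ∑core≈ε = begin
          ∑ (pair o a b ∪ ⁅ o ⊕ c ⁆)       ≈⟨ subsetSum-∪ e ab#c ⟩
          ∑ (pair o a b) ∙ ∑ ⁅ o ⊕ c ⁆     ≈⟨ ∙-cong (∑-pair o a≢b) (trans (subsetSum-⁅⁆ e _) (e-⊕ o c)) ⟩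
          (e a ∙ e b) ∙ (e o ∙ e c)        ≈⟨ ∙-cong ab≈c (eo∙x≈x _) ⟩
          e c ∙ e c                        ≈⟨ e-square c ⟩
          ε                                ∎ }
      where
      ab#c : Disjoint (pair o a b) ⁅ o ⊕ c ⁆
      ab#c = disjoint-⊆ id (q⊆p∪q _ _) (pair-disjoint o a≢o (c≢a ∘ ≡.sym) b≢o (c≢b ∘ ≡.sym))

    seed₆ : 12 ≤ n → Seed 6 12
    seed₆ 12≤n = record
      { core = pair o a b ∪ (pair x o a ∪ pair y o b)
      ; hull = coset o ∪ (coset x ∪ coset y)
      ; hull-closed = closed-∪ (coset-closed o) (closed-∪ (coset-closed x) (coset-closed y))
      ; ∣hull∣ = ≡.trans (∣p∪q∣≡∣p∣+∣q∣ o#xy) (cong₂ _+_ (∣coset∣≡4 o)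
                   (≡.trans (∣p∪q∣≡∣p∣+∣q∣ x#y) (cong₂ _+_ (∣coset∣≡4 x) (∣coset∣≡4 y))))
      ; core⊆hull = ∪-mono oab⊆ (∪-mono xoa⊆ yob⊆)
      ; ∣core∣ = ≡.trans (∣p∪q∣≡∣p∣+∣q∣ oab#xoa∪yob) (cong₂ _+_ (∣pair∣≡2 o a≢b)
                   (≡.trans (∣p∪q∣≡∣p∣+∣q∣ xoa#yob)
                            (cong₂ _+_ (∣pair∣≡2 x (a≢o ∘ ≡.sym)) (∣pair∣≡2 y (b≢o ∘ ≡.sym)))))
      ; ∑core≈ε = begin
          ∑ (pair o a b ∪ (pair x o a ∪ pair y o b))
            ≈⟨ trans (subsetSum-∪ e oab#xoa∪yob) (∙-congˡ (subsetSum-∪ e xoa#yob)) ⟩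
          ∑ (pair o a b) ∙ (∑ (pair x o a) ∙ ∑ (pair y o b))
            ≈⟨ ∙-cong (∑-pair o a≢b) (∙-cong (∑-pair x (a≢o ∘ ≡.sym)) (∑-pair y (b≢o ∘ ≡.sym))) ⟩
          (e a ∙ e b) ∙ ((e o ∙ e a) ∙ (e o ∙ e b))
            ≈⟨ ∙-congˡ (∙-square-cancel (e-square o) _ _) ⟩
          (e a ∙ e b) ∙ (e a ∙ e b)
            ≈⟨ trans (∙-cong ab≈c ab≈c) (e-square c) ⟩
          ε ∎ }
      where
      ∣coset∣<n : ∣ coset o ∣ < n
      ∣coset∣<n = subst (_< n) (≡.sym (∣coset∣≡4 o)) (≤-trans (m≤m+n 5 7) 12≤n)
      x : Fin n
      x = proj₁ (∃-coset-disjoint (coset-closed o) ∣coset∣<n)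
      x#o : Disjoint (coset x) (coset o)
      x#o = proj₂ (∃-coset-disjoint (coset-closed o) ∣coset∣<n)
      ∣cosets∣<n : ∣ coset o ∪ coset x ∣ < n
      ∣cosets∣<n =
        subst (_< n) (≡.sym (≡.trans (∣p∪q∣≡∣p∣+∣q∣ (disjoint-sym x#o)) (cong₂ _+_ (∣coset∣≡4 o) (∣coset∣≡4 x))))
              (≤-trans (m≤m+n 9 3) 12≤n)
      y : Fin n
      y = proj₁ (∃-coset-disjoint (closed-∪ (coset-closed o) (coset-closed x)) ∣cosets∣<n)
      y#ox : Disjoint (coset y) (coset o ∪ coset x)
      y#ox = proj₂ (∃-coset-disjoint (closed-∪ (coset-closed o) (coset-closed x)) ∣cosets∣<n)
      x#y : Disjoint (coset x) (coset y)
      x#y = disjoint-sym (disjoint-⊆ id (q⊆p∪q _ _) y#ox)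
      o#xy : Disjoint (coset o) (coset x ∪ coset y)
      o#xy = disjoint-sym (disjoint-∪ˡ x#o (disjoint-⊆ id (p⊆p∪q _) y#ox))
      oab⊆ : pair o a b ⊆ coset o
      oab⊆ = pair⊆coset o a∈H b∈H
      xoa⊆ : pair x o a ⊆ coset x
      xoa⊆ = pair⊆coset x o∈H a∈H
      yob⊆ : pair y o b ⊆ coset y
      yob⊆ = pair⊆coset y o∈H b∈H
      xoa#yob : Disjoint (pair x o a) (pair y o b)
      xoa#yob = disjoint-⊆ xoa⊆ yob⊆ x#y
      oab#xoa∪yob : Disjoint (pair o a b) (pair x o a ∪ pair y o b)
      oab#xoa∪yob = disjoint-⊆ oab⊆ (∪-mono xoa⊆ yob⊆) o#xy

    4≤n : 4 ≤ n
    4≤n = subst (_≤ n) (∣coset∣≡4 o) (∣p∣≤n (coset o))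

    ∑-full≈ε : 4 ∣ n → ∑ full ≈ ε
    ∑-full≈ε (divides t n≡t*4) = trans (reflexive (cong ∑ (≡.sym set≡full))) sum≈ε
      where
      open CosetUnion (cosetUnion closed-∅ t
        (subst (λ k → k + t * 4 ≤ n) (≡.sym (∣⊥∣≡0 n)) (≤-reflexive (≡.sym n≡t*4))))
      set≡full : set ≡ full
      set≡full = ∣p∣≡n⇒p≡⊤ (≡.trans card (≡.sym n≡t*4))

    noZeroSum-pair : ∀ {R} → ∣ R ∣ ≡ 2 → ¬ ∑ R ≈ ε
    noZeroSum-pair ∣R∣≡2 ∑R≈ε with subsetSum-∣p∣≡2 e ∣R∣≡2
    ... | i , j , i≢j , ∑R≈ij = i≢j (e-injective (x∙y≈ε⇒x≈y (e-square j) (trans (sym ∑R≈ij) ∑R≈ε)))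

    noZeroSum-copair : 4 ∣ n → ∀ {R} → ∣ R ∣ ≡ n ∸ 2 → ¬ ∑ R ≈ ε
    noZeroSum-copair 4∣n {R} ∣R∣≡n∸2 ∑R≈ε = noZeroSum-pair ∣∁R∣≡2 ∑∁R≈ε
      where
      R#∁R : Disjoint R (∁ R)
      R#∁R x∈R x∈∁R = x∈∁p⇒x∉p x∈∁R x∈R
      ∣∁R∣≡2 : ∣ ∁ R ∣ ≡ 2
      ∣∁R∣≡2 = ≡.trans (∣∁p∣≡n∸∣p∣ R)
                 (≡.trans (cong (n ∸_) ∣R∣≡n∸2) (m∸[m∸n]≡n (≤-trans (m≤m+n 2 2) 4≤n)))
      ∑∁R≈ε : ∑ (∁ R) ≈ ε
      ∑∁R≈ε = begin
        ∑ (∁ R)        ≈⟨ identityˡ _ ⟨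
        ε ∙ ∑ (∁ R)    ≈⟨ ∙-congʳ ∑R≈ε ⟨
        ∑ R ∙ ∑ (∁ R)  ≈⟨ subsetSum-∪ e R#∁R ⟨
        ∑ (R ∪ ∁ R)    ≡⟨ cong ∑ (p∪∁p≡⊤ R) ⟩
        ∑ full         ≈⟨ ∑-full≈ε 4∣n ⟩
        ε              ∎

    zeroSumOfSize : 4 ∣ n → ∀ {r} → r ≤ n → r ≢ 2 → r ≢ n ∸ 2 → ZeroSumOfSize r
    zeroSumOfSize 4∣n {r} r≤n r≢2 r≢n∸2 with mod4 r
    ... | rem0 m = grow seed₀ m r≤n
    ... | rem1 m = grow seed₁ m (m*4<n⇒[1+m]*4≤n {m = m} 4∣n r≤n)
    ... | rem3 m = grow seed₃ m (m*4<n⇒[1+m]*4≤n {m = m} 4∣n (≤-trans (s≤s (m≤n+m (m * 4) 2)) r≤n))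
    ... | rem2 zero = ⊥-elim (r≢2 refl)
    ... | rem2 (suc m) = grow (seed₆ (≤-trans (m≤m+n 12 (m * 4)) room)) m room
      where room = [1+m]*4+2≤n⇒[3+m]*4≤n {m = m} 4∣n r≤n r≢n∸2

    zeroSumOfSize⇔ : 4 ∣ n → ∀ {r} → r ≤ n → ZeroSumOfSize r ⇔ (r ≢ 2 × r ≢ n ∸ 2)
    zeroSumOfSize⇔ 4∣n r≤n = mk⇔
      (λ (R , ∣R∣≡r , ∑R≈ε) → (λ r≡2 → noZeroSum-pair (≡.trans ∣R∣≡r r≡2) ∑R≈ε) ,
                              (λ r≡n∸2 → noZeroSum-copair 4∣n (≡.trans ∣R∣≡r r≡n∸2) ∑R≈ε))
      (λ (r≢2 , r≢n∸2) → zeroSumOfSize 4∣n r≤n r≢2 r≢n∸2)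

  module _ {m : ℕ} (inv : Fin m → Carrier) (enum : EnumeratesInvolutions G inv) where

    withZero-square : ∀ i → withZero G inv i ∙ withZero G inv i ≈ ε
    withZero-square Fin.zero = identityˡ ε
    withZero-square (Fin.suc j) = proj₂ (proj₁ enum j)

    withZero-injective : ∀ {i j} → withZero G inv i ≈ withZero G inv j → i ≡ j
    withZero-injective {Fin.zero} {Fin.zero} _ = refl
    withZero-injective {Fin.zero} {Fin.suc j} ε≈inv = ⊥-elim (proj₁ (proj₁ enum j) (sym ε≈inv))
    withZero-injective {Fin.suc i} {Fin.zero} inv≈ε = ⊥-elim (proj₁ (proj₁ enum i) inv≈ε)
    withZero-injective {Fin.suc i} {Fin.suc j} inv≈inv = cong Fin.suc (proj₁ (proj₂ enum) i j inv≈inv)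

    withZero-closed : ∀ i j → ∃ λ l → withZero G inv l ≈ withZero G inv i ∙ withZero G inv j
    withZero-closed i j with i Fin.≟ j
    ... | yes refl = Fin.zero , sym (withZero-square i)
    ... | no i≢j = Fin.suc (proj₁ found) , sym (proj₂ found)
      where
      ij-involution : IsInvolution G (withZero G inv i ∙ withZero G inv j)
      ij-involution =
        (λ ij≈ε → i≢j (withZero-injective (x∙y≈ε⇒x≈y (withZero-square j) ij≈ε))) ,
        trans (∙-square-cancel (withZero-square i) _ _) (withZero-square j)
      found : ∃ λ l → withZero G inv i ∙ withZero G inv j ≈ inv l
      found = proj₂ (proj₂ enum) _ ij-involution

  zeroSumOfInvolutions⇔ : ∀ {m} (inv : Fin m → Carrier) → EnumeratesInvolutions G inv →
    2 ≤ m → 4 ∣ suc m → ∀ {r} → r ≤ suc m →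
    (Σ (Subset (suc m)) λ R → (∣ R ∣ ≡ r) × subsetSum G (withZero G inv) R ≈ ε) ⇔ (r ≢ 2 × r ≢ suc m ∸ 2)
  zeroSumOfInvolutions⇔ inv enum (s≤s (s≤s _)) =
    ElementaryTwoGroup.zeroSumOfSize⇔ (withZero G inv)
      (withZero-injective inv enum) (withZero-square inv enum) (withZero-closed inv enum)
      Fin.zero (Fin.suc Fin.zero) (Fin.suc (Fin.suc Fin.zero)) ≈-refl (λ ()) (λ ()) (λ ())

4∣2^k : ∀ {k} → 2 ≤ k → 4 ∣ 2 ^ k
4∣2^k {suc zero} (s≤s ())
4∣2^k {suc (suc k)} _ = subst (4 ∣_) (*-assoc 2 2 (2 ^ k)) (m∣m*n (2 ^ k))

lemma2p3 : {c ℓ : Level} (G : AbelianGroup c ℓ) (k : ℕ) → 2 ≤ k →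
    (inv : Fin (2 ^ k ∸ 1) → AbelianGroup.Carrier G) →
    EnumeratesInvolutions G inv →
    (r : ℕ) → r ≤ 2 ^ k →
    (Σ (Subset (suc (2 ^ k ∸ 1))) (λ R → (∣ R ∣ ≡ r) × AbelianGroup._≈_ G (subsetSum G (withZero G inv) R) (AbelianGroup.ε G)))
      ⇔ (¬ (r ≡ 2) × ¬ (r ≡ 2 ^ k ∸ 2))
lemma2p3 {ℓ = ℓ} G k 2≤k inv enum r r≤2^k =
  subst (λ N → ZeroSumSets ⇔ (r ≢ 2 × r ≢ N ∸ 2)) 1+[2^k∸1]≡2^k
    (zeroSumOfInvolutions⇔ G inv enum 2≤2^k∸1
      (subst (4 ∣_) (≡.sym 1+[2^k∸1]≡2^k) (4∣2^k 2≤k))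
      (subst (r ≤_) (≡.sym 1+[2^k∸1]≡2^k) r≤2^k))
  where
  ZeroSumSets : Set ℓ
  ZeroSumSets = Σ (Subset (suc (2 ^ k ∸ 1))) λ R →
    (∣ R ∣ ≡ r) × AbelianGroup._≈_ G (subsetSum G (withZero G inv) R) (AbelianGroup.ε G)
  1+[2^k∸1]≡2^k : suc (2 ^ k ∸ 1) ≡ 2 ^ k
  1+[2^k∸1]≡2^k = suc-pred (2 ^ k) {{m^n≢0 2 k}}
  2≤2^k∸1 : 2 ≤ 2 ^ k ∸ 1
  2≤2^k∸1 = ≤-trans (n≤1+n 2) (∸-monoˡ-≤ 1 (^-monoʳ-≤ 2 2≤k))
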